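{- Let $T$ be a tiling of the $n$-gon $P$ and $i$ a vertex. Then $\mathrm{Scott}(T)(i+1)=i$ (i.e. there is a strand $i+1\leadsto i$) if and only if the edge $[i,i+1]$ is simple in $T$.
   Context: Let $P$ be a convex polygon with vertices labelled $1,\dots,n$ ($n\ge3$) in clockwise order, labels modulo $n$. A tiling $T$ is a (possibly empty) set of pairwise non-crossing (in their interiors) diagonals; tiles are the closures of the components of $P$ minus the diagonals. A vertex is simple in $T$ if it is not an endpoint of any diagonal of $T$; a boundary edge $[i,i+1]$ is simple in $T$ if both $i$ and $i+1$ are simple. Scott map: for each tile $Q$ with vertices $q_1,\dots,q_r$ in clockwise order (indices mod $r$) and each $j$, draw inside $Q$ a strand segment parallel to $[q_{j-1},q_j]$, entering $Q$ through the side $[q_j,q_{j+1}]$ near $q_j$ and leaving $Q$ through the side $[q_{j-2},q_{j-1}]$ near $q_{j-1}$; if the entering side is a boundary edge of $P$ the segment starts at vertex $q_j$, and if the leaving side is a boundary edge it ends at vertex $q_{j-1}$. At a diagonal shared by two tiles, a segment leaving one tile near an endpoint $v$ is continued by the segment of the other tile entering near $v$. Concatenation gives strands $x\leadsto y$; each vertex starts and ends exactly one strand, and $\mathrm{Scott}(T)$ is the permutation $x\mapsto y$. -}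

module Defs where

open import Data.Nat using (ℕ; zero; suc; _+_; _*_; _∸_; _<_; _%_)
open import Data.Nat.DivMod using (m%n<n)
open import Data.Fin using (Fin; toℕ; fromℕ<; _≟_)
open import Data.Bool using (Bool; true; false; if_then_else_; _∨_; _∧_)
open import Data.List using (List)
open import Data.Bool.ListAction using (any)
open import Data.List.Relation.Unary.All using (All)
open import Data.List.Membership.Propositional using (_∈_)
open import Data.Product using (_×_; _,_; proj₁; proj₂)
open import Data.Sum using (_⊎_)
open import Relation.Nullary using (¬_)
open import Relation.Nullary.Decidable using (⌊_⌋)
open import Relation.Binary.PropositionalEquality using (_≡_; _≢_)

-- Vertices of the n-gon are Fin n (label k ↔ vertex k, read modulo n),
-- numbered clockwise.

_⊕_ : ∀ {n} → Fin n → ℕ → Fin n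
_⊕_ {suc m} v k = fromℕ< (m%n<n (toℕ v + k) (suc m))

offset : ∀ {n} → Fin n → Fin n → ℕ
offset {suc m} v w = (toℕ w + (suc m ∸ toℕ v)) % suc m

IsDiagonal : ∀ {n} → Fin n × Fin n → Set
IsDiagonal (i , j) = (i ≢ j) × (j ≢ i ⊕ 1) × (i ≢ j ⊕ 1)

Between : ∀ {n} → Fin n → Fin n → Fin n → Set
Between a x b = (0 < offset a x) × (offset a x < offset a b)

Crosses : ∀ {n} → Fin n × Fin n → Fin n × Fin n → Set
Crosses (a , b) (c , d) =
  (a ≢ c) × (a ≢ d) × (b ≢ c) × (b ≢ d) ×
  ((Between a c b × ¬ Between a d b) ⊎ (¬ Between a c b × Between a d b))

record Tiling (n : ℕ) : Set where
  field
    diags    : List (Fin n × Fin n)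
    areDiags : All IsDiagonal diags
    nonCross : ∀ {d e} → d ∈ diags → e ∈ diags → ¬ Crosses d e
open Tiling public

Simple : ∀ {n} → Tiling n → Fin n → Set
Simple T v = ∀ {d} → d ∈ diags T → (proj₁ d ≢ v) × (proj₂ d ≢ v)

SimpleEdge : ∀ {n} → Tiling n → Fin n → Set
SimpleEdge T i = Simple T i × Simple T (i ⊕ 1)

-- Combinatorial description of the Scott map.
-- v and w are joined by a side of some tile (boundary edge or diagonal of T)

joined : ∀ {n} → List (Fin n × Fin n) → Fin n → Fin n → Bool
joined ds v w =
  ⌊ w ≟ v ⊕ 1 ⌋ ∨ ⌊ v ≟ w ⊕ 1 ⌋ ∨
  any (λ e → (⌊ proj₁ e ≟ v ⌋ ∧ ⌊ proj₂ e ≟ w ⌋) ∨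
             (⌊ proj₁ e ≟ w ⌋ ∧ ⌊ proj₂ e ≟ v ⌋)) ds

scan : ∀ {n} → List (Fin n × Fin n) → Fin n → ℕ → ℕ → Fin n
scan ds a zero    k = a
scan ds a (suc f) k = if joined ds a (a ⊕ k) then a ⊕ k else scan ds a f (suc k)

-- If a → b are consecutive (clockwise) vertices of a tile, then
-- prevVertex ds a b is the vertex preceding a in that tile: the
-- neighbour of a following b in clockwise order around a.
prevVertex : ∀ {n} → List (Fin n × Fin n) → Fin n → Fin n → Fin n
prevVertex {n} ds a b = scan ds a n (suc (offset a b))

-- A strand segment entering a tile through its side (a , b) (clockwise,
-- near a) leaves through the side (c , d), where d = prev a and
-- c = prev d; if (c , d) is a boundary edge the strand ends at d,
-- otherwise it continues in the adjacent tile, entering through (d , c).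
walk : ∀ {n} → List (Fin n × Fin n) → ℕ → Fin n → Fin n → Fin n
walk ds zero    a b = a
walk ds (suc f) a b =
  let d = prevVertex ds a b
      c = prevVertex ds d a
  in if ⌊ d ≟ c ⊕ 1 ⌋ then d else walk ds f d c

-- Scott(T)(x) = y where x ⇝ y: the strand starts at x on the boundary
-- edge (x , x+1).  Fuel 3n exceeds the total number of strand segments
-- (n + 2·#diagonals), so it never runs out.
Scott : ∀ {n} → Tiling n → Fin n → Fin n
Scott {n} T x = walk (diags T) (3 * n) x (x ⊕ 1)

-- Put x = i + 1 and give the vertex x ⊕ P the coordinate P, with x itself at
-- coordinate N. The strand from x enters its first tile through the side
-- (N , 1). A strand entering a tile through a side (A , B) leaves it through the
-- side (C , D) with 1 ≤ C < D < A: D is the first neighbour of A after B, and C,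
-- the first neighbour of D after A, cannot lie on the arc (A , N], since then
-- [D , C] would cross the diagonal [A , B]. So coordinates strictly decrease
-- along a strand, and the strand from x ends at i = x ⊕ (N - 1) exactly when it
-- stops after its first turn with D = N - 1 and C = N - 2. The first condition
-- says that x has no neighbour strictly between x + 1 and i, i.e. x is simple,
-- and the second says the same of i.

module Submission where

open import Defs
open import Data.Bool using (Bool; true; false; T; _∨_; _∧_)
open import Data.Bool.Properties using (T-∨; T-∧; T-≡)
open import Data.Fin using (Fin; toℕ; _≟_)
open import Data.Fin.Properties using (toℕ-fromℕ<; toℕ-injective; toℕ<n)
open import Data.List using (List; _∷_)
open import Data.List.Membership.Propositional using (_∈_)
open import Data.List.Relation.Unary.Any as Any using (Any; here; there)
open import Data.List.Relation.Unary.Any.Properties using (any⁺; any⁻)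
import Data.List.Relation.Unary.All as All
open import Data.Nat using (ℕ; zero; suc; _+_; _*_; _∸_; _≤_; _<_; _%_; _≤?_; z≤n; s≤s; z<s)
open import Data.Nat.DivMod using (m%n<n; m<n⇒m%n≡m; m%n%n≡m%n; [m+n]%n≡m%n; %-distribˡ-+)
open import Data.Nat.Properties hiding (_≟_)
open import Data.Product using (_×_; _,_; proj₁; proj₂; ∃-syntax)
import Data.Product as Prod
open import Data.Sum using (_⊎_; inj₁; inj₂)
import Data.Sum as Sum
open import Function using (_∘_)
open import Function.Bundles using (_⇔_; mk⇔; Equivalence)
open import Relation.Nullary using (¬_; Dec; yes; no; contradiction)
open import Relation.Nullary.Decidable using (⌊_⌋; fromWitness)
open import Relation.Binary.PropositionalEquality

record LeastFrom (P : ℕ → Set) (k j : ℕ) : Set where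
  field
    from  : k ≤ j
    holds : P j
    least : ∀ {i} → k ≤ i → i < j → ¬ P i

LeastFrom-suc⁻ : ∀ {P k j} → ¬ P k → LeastFrom P (suc k) j → LeastFrom P k j
LeastFrom-suc⁻ {P} {k} {j} ¬Pk L = record
  { from  = ≤-trans (n≤1+n k) (LeastFrom.from L)
  ; holds = LeastFrom.holds L
  ; least = least
  }
  where
  least : ∀ {i} → k ≤ i → i < j → ¬ P i
  least k≤i i<j with m≤n⇒m<n∨m≡n k≤i
  ... | inj₁ k<i  = LeastFrom.least L k<i i<j
  ... | inj₂ refl = ¬Pk

module _ {m : ℕ} where

  private
    N : ℕ
    N = suc m

  toℕ-⊕ : (v : Fin N) (k : ℕ) → toℕ (v ⊕ k) ≡ (toℕ v + k) % N
  toℕ-⊕ v k = toℕ-fromℕ< (m%n<n (toℕ v + k) N)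

  private
    [i%N+j]%N≡[i+j]%N : ∀ i j → (i % N + j) % N ≡ (i + j) % N
    [i%N+j]%N≡[i+j]%N i j = begin
      (i % N + j) % N           ≡⟨ %-distribˡ-+ (i % N) j N ⟩
      (i % N % N + j % N) % N   ≡⟨ cong (λ r → (r + j % N) % N) (m%n%n≡m%n i N) ⟩
      (i % N + j % N) % N       ≡⟨ %-distribˡ-+ i j N ⟨
      (i + j) % N               ∎
      where open ≡-Reasoning

    [v+k]+[N∸v]≡k+N : ∀ {v} k → v ≤ N → v + k + (N ∸ v) ≡ k + N
    [v+k]+[N∸v]≡k+N {v} k v≤N = begin
      v + k + (N ∸ v)   ≡⟨ cong (_+ (N ∸ v)) (+-comm v k) ⟩
      k + v + (N ∸ v)   ≡⟨ +-assoc k v (N ∸ v) ⟩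
      k + (v + (N ∸ v)) ≡⟨ cong (k +_) (m+[n∸m]≡n v≤N) ⟩
      k + N             ∎
      where open ≡-Reasoning

  ⊕-+ : (v : Fin N) (p q : ℕ) → (v ⊕ p) ⊕ q ≡ v ⊕ (p + q)
  ⊕-+ v p q = toℕ-injective (begin
    toℕ ((v ⊕ p) ⊕ q)         ≡⟨ toℕ-⊕ (v ⊕ p) q ⟩
    (toℕ (v ⊕ p) + q) % N     ≡⟨ cong (λ r → (r + q) % N) (toℕ-⊕ v p) ⟩
    ((toℕ v + p) % N + q) % N ≡⟨ [i%N+j]%N≡[i+j]%N (toℕ v + p) q ⟩
    (toℕ v + p + q) % N       ≡⟨ cong (_% N) (+-assoc (toℕ v) p q) ⟩
    (toℕ v + (p + q)) % N     ≡⟨ toℕ-⊕ v (p + q) ⟨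
    toℕ (v ⊕ (p + q))         ∎)
    where open ≡-Reasoning

  ⊕-suc : (v : Fin N) (k : ℕ) → (v ⊕ k) ⊕ 1 ≡ v ⊕ suc k
  ⊕-suc v k = trans (⊕-+ v k 1) (cong (v ⊕_) (+-comm k 1))

  ⊕-identityʳ : (v : Fin N) → v ⊕ 0 ≡ v
  ⊕-identityʳ v = toℕ-injective (begin
    toℕ (v ⊕ 0)      ≡⟨ toℕ-⊕ v 0 ⟩
    (toℕ v + 0) % N  ≡⟨ cong (_% N) (+-identityʳ (toℕ v)) ⟩
    toℕ v % N        ≡⟨ m<n⇒m%n≡m (toℕ<n v) ⟩
    toℕ v            ∎)
    where open ≡-Reasoning

  ⊕-periodic : (v : Fin N) (k : ℕ) → v ⊕ (k + N) ≡ v ⊕ k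
  ⊕-periodic v k = toℕ-injective (begin
    toℕ (v ⊕ (k + N))      ≡⟨ toℕ-⊕ v (k + N) ⟩
    (toℕ v + (k + N)) % N  ≡⟨ cong (_% N) (+-assoc (toℕ v) k N) ⟨
    (toℕ v + k + N) % N    ≡⟨ [m+n]%n≡m%n (toℕ v + k) N ⟩
    (toℕ v + k) % N        ≡⟨ toℕ-⊕ v k ⟨
    toℕ (v ⊕ k)            ∎)
    where open ≡-Reasoning

  ⊕-N : (v : Fin N) → v ⊕ N ≡ v
  ⊕-N v = trans (⊕-periodic v 0) (⊕-identityʳ v)

  offset-⊕ : (v : Fin N) (k : ℕ) → offset v (v ⊕ k) ≡ k % N
  offset-⊕ v k = begin
    (toℕ (v ⊕ k) + (N ∸ toℕ v)) % N           ≡⟨ cong (λ r → (r + (N ∸ toℕ v)) % N) (toℕ-⊕ v k) ⟩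
    ((toℕ v + k) % N + (N ∸ toℕ v)) % N       ≡⟨ [i%N+j]%N≡[i+j]%N (toℕ v + k) (N ∸ toℕ v) ⟩
    (toℕ v + k + (N ∸ toℕ v)) % N             ≡⟨ cong (_% N) ([v+k]+[N∸v]≡k+N k (<⇒≤ (toℕ<n v))) ⟩
    (k + N) % N                               ≡⟨ [m+n]%n≡m%n k N ⟩
    k % N                                     ∎
    where open ≡-Reasoning

  ⊕-offset : (v w : Fin N) → v ⊕ offset v w ≡ w
  ⊕-offset v w = toℕ-injective (begin
    toℕ (v ⊕ offset v w)                       ≡⟨ toℕ-⊕ v (offset v w) ⟩
    (toℕ v + (toℕ w + (N ∸ toℕ v)) % N) % N   ≡⟨ cong (_% N) (+-comm (toℕ v) _) ⟩
    ((toℕ w + (N ∸ toℕ v)) % N + toℕ v) % N   ≡⟨ [i%N+j]%N≡[i+j]%N (toℕ w + (N ∸ toℕ v)) (toℕ v) ⟩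
    (toℕ w + (N ∸ toℕ v) + toℕ v) % N         ≡⟨ cong (_% N) (+-assoc (toℕ w) _ (toℕ v)) ⟩
    (toℕ w + ((N ∸ toℕ v) + toℕ v)) % N       ≡⟨ cong (λ r → (toℕ w + r) % N) (m∸n+n≡m (<⇒≤ (toℕ<n v))) ⟩
    (toℕ w + N) % N                           ≡⟨ [m+n]%n≡m%n (toℕ w) N ⟩
    toℕ w % N                                 ≡⟨ m<n⇒m%n≡m (toℕ<n w) ⟩
    toℕ w                                     ∎)
    where open ≡-Reasoning

  offset<N : (v w : Fin N) → offset v w < N
  offset<N v w = m%n<n (toℕ w + (N ∸ toℕ v)) N

  module _ (x : Fin N) where

    offset-⊕-⊕ : ∀ {P Q} → P ≤ Q → Q < P + N → offset (x ⊕ P) (x ⊕ Q) ≡ Q ∸ P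
    offset-⊕-⊕ {P} {Q} P≤Q Q<P+N = begin
      offset (x ⊕ P) (x ⊕ Q)                  ≡⟨ cong (offset (x ⊕ P) ∘ (x ⊕_)) (m+[n∸m]≡n P≤Q) ⟨
      offset (x ⊕ P) (x ⊕ (P + (Q ∸ P)))      ≡⟨ cong (offset (x ⊕ P)) (⊕-+ x P (Q ∸ P)) ⟨
      offset (x ⊕ P) ((x ⊕ P) ⊕ (Q ∸ P))      ≡⟨ offset-⊕ (x ⊕ P) (Q ∸ P) ⟩
      (Q ∸ P) % N                             ≡⟨ m<n⇒m%n≡m (m<n+o⇒m∸n<o Q P Q<P+N) ⟩
      Q ∸ P                                   ∎
      where open ≡-Reasoning

    ⊕-injective : ∀ {P Q} → P ≤ Q → Q < P + N → x ⊕ P ≡ x ⊕ Q → P ≡ Q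
    ⊕-injective {P} {Q} P≤Q Q<P+N eq = ≤-antisym P≤Q (m∸n≡0⇒m≤n (begin
      Q ∸ P                    ≡⟨ offset-⊕-⊕ P≤Q Q<P+N ⟨
      offset (x ⊕ P) (x ⊕ Q)   ≡⟨ cong (offset (x ⊕ P)) eq ⟨
      offset (x ⊕ P) (x ⊕ P)   ≡⟨ offset-⊕-⊕ ≤-refl (m<m+n P z<s) ⟩
      P ∸ P                    ≡⟨ n∸n≡0 P ⟩
      0                        ∎))
      where open ≡-Reasoning

    ⊕-distinct : ∀ {P Q} → P < Q → Q < P + N → x ⊕ P ≢ x ⊕ Q
    ⊕-distinct P<Q Q<P+N eq = <⇒≢ P<Q (⊕-injective (<⇒≤ P<Q) Q<P+N eq)

    Between-⊕ : ∀ {P Y Q} → P < Y → Y < Q → Q < P + N → Between (x ⊕ P) (x ⊕ Y) (x ⊕ Q)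
    Between-⊕ {P} {Y} {Q} P<Y Y<Q Q<P+N
      rewrite offset-⊕-⊕ (<⇒≤ P<Y) (<-trans Y<Q Q<P+N)
            | offset-⊕-⊕ (<⇒≤ (<-trans P<Y Y<Q)) Q<P+N
      = m<n⇒0<n∸m P<Y , ∸-monoˡ-< Y<Q (<⇒≤ P<Y)

    ¬Between-⊕ : ∀ {P Y Q} → P ≤ Q → Q ≤ Y → Y < P + N → ¬ Between (x ⊕ P) (x ⊕ Y) (x ⊕ Q)
    ¬Between-⊕ {P} {Y} {Q} P≤Q Q≤Y Y<P+N
      rewrite offset-⊕-⊕ (≤-trans P≤Q Q≤Y) Y<P+N
            | offset-⊕-⊕ P≤Q (≤-<-trans Q≤Y Y<P+N)
      = λ (_ , Y∸P<Q∸P) → ≤⇒≯ (∸-monoˡ-≤ P Q≤Y) Y∸P<Q∸P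

    interleaved-Crosses : ∀ {P Q R S} → P < Q → Q < R → R < S → S < P + N →
                          Crosses (x ⊕ P , x ⊕ R) (x ⊕ Q , x ⊕ S)
    interleaved-Crosses {P} {Q} {R} {S} P<Q Q<R R<S S<P+N =
      ⊕-distinct P<Q (<-trans Q<S S<P+N) ,
      ⊕-distinct P<S S<P+N ,
      (λ eq → ⊕-distinct Q<R (<-trans R<S S<Q+N) (sym eq)) ,
      ⊕-distinct R<S (<-trans S<P+N (+-monoˡ-< N P<R)) ,
      inj₁ (Between-⊕ P<Q Q<R R<P+N , ¬Between-⊕ (<⇒≤ P<R) (<⇒≤ R<S) S<P+N)
      where
      P<R : P < R
      P<R = <-trans P<Q Q<R
      Q<S : Q < S
      Q<S = <-trans Q<R R<S
      P<S : P < S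
      P<S = <-trans P<R R<S
      R<P+N : R < P + N
      R<P+N = <-trans R<S S<P+N
      S<Q+N : S < Q + N
      S<Q+N = <-trans S<P+N (+-monoˡ-< N P<Q)

  Chord : List (Fin N × Fin N) → Fin N → Fin N → Set
  Chord ds v w = (v , w) ∈ ds ⊎ (w , v) ∈ ds

  Adjacent : List (Fin N × Fin N) → Fin N → Fin N → Set
  Adjacent ds v w = w ≡ v ⊕ 1 ⊎ v ≡ w ⊕ 1 ⊎ Chord ds v w

  module _ {ds : List (Fin N × Fin N)} {v w : Fin N} where

    private
      matches : Fin N × Fin N → Bool
      matches (p , q) = (⌊ p ≟ v ⌋ ∧ ⌊ q ≟ w ⌋) ∨ (⌊ p ≟ w ⌋ ∧ ⌊ q ≟ v ⌋)

      any-matches⇒Chord : ∀ {es} → Any (T ∘ matches) es → Chord es v w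
      any-matches⇒Chord (there h) = Sum.map there there (any-matches⇒Chord h)
      any-matches⇒Chord {(p , q) ∷ _} (here h) with p ≟ v | q ≟ w | p ≟ w | q ≟ v
      ... | yes refl | yes refl | _        | _        = inj₁ (here refl)
      ... | yes _    | no _     | yes refl | yes refl = inj₂ (here refl)
      ... | no _     | _        | yes refl | yes refl = inj₂ (here refl)
      any-matches⇒Chord (here ()) | yes _ | no _ | yes _ | no _
      any-matches⇒Chord (here ()) | yes _ | no _ | no _  | _
      any-matches⇒Chord (here ()) | no _  | _    | yes _ | no _
      any-matches⇒Chord (here ()) | no _  | _    | no _  | _

      self : Fin N → Fin N → Bool
      self u u′ = ⌊ u ≟ u ⌋ ∧ ⌊ u′ ≟ u′ ⌋

      T-self : ∀ u u′ → T (self u u′)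
      T-self u u′ = Equivalence.from (T-∧ {⌊ u ≟ u ⌋} {⌊ u′ ≟ u′ ⌋})
                      (fromWitness {a? = u ≟ u} refl , fromWitness {a? = u′ ≟ u′} refl)

      Chord⇒any-matches : Chord ds v w → Any (T ∘ matches) ds
      Chord⇒any-matches (inj₁ vw) = Any.map (λ { refl → matches-vw }) vw
        where
        matches-vw : T (matches (v , w))
        matches-vw = Equivalence.from (T-∨ {self v w} {⌊ v ≟ w ⌋ ∧ ⌊ w ≟ v ⌋}) (inj₁ (T-self v w))
      Chord⇒any-matches (inj₂ wv) = Any.map (λ { refl → matches-wv }) wv
        where
        matches-wv : T (matches (w , v))
        matches-wv = Equivalence.from (T-∨ {⌊ w ≟ v ⌋ ∧ ⌊ v ≟ w ⌋} {self w v}) (inj₂ (T-self w v))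

    joined⇔Adjacent : T (joined ds v w) ⇔ Adjacent ds v w
    joined⇔Adjacent = mk⇔ to from
      where
      to : T (joined ds v w) → Adjacent ds v w
      to h with w ≟ v ⊕ 1 | v ≟ w ⊕ 1
      ... | yes e | _     = inj₁ e
      ... | no _  | yes e = inj₂ (inj₁ e)
      ... | no _  | no _  = inj₂ (inj₂ (any-matches⇒Chord (any⁻ matches ds h)))
      from : Adjacent ds v w → T (joined ds v w)
      from adj with w ≟ v ⊕ 1 | v ≟ w ⊕ 1 | adj
      ... | yes _ | _     | _ = _
      ... | no _  | yes _ | _ = _
      ... | no ¬e | no _  | inj₁ e = contradiction e ¬e
      ... | no _  | no ¬e | inj₂ (inj₁ e) = contradiction e ¬e
      ... | no _  | no _  | inj₂ (inj₂ c) = any⁺ matches (Chord⇒any-matches c)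

  Crosses-swapʳ : ∀ {d : Fin N × Fin N} {c e : Fin N} → Crosses d (c , e) → Crosses d (e , c)
  Crosses-swapʳ (a≢c , a≢e , b≢c , b≢e , between) =
    a≢e , a≢c , b≢e , b≢c , Sum.swap (Sum.map Prod.swap Prod.swap between)

  IsDiagonal-swap : ∀ {v w : Fin N} → IsDiagonal (w , v) → IsDiagonal (v , w)
  IsDiagonal-swap (w≢v , v≢w⁺ , w≢v⁺) = ≢-sym w≢v , w≢v⁺ , v≢w⁺

  module _ (T : Tiling N) where

    adjacent-simple : ∀ {v w} → Simple T v → Adjacent (diags T) v w → w ≡ v ⊕ 1 ⊎ v ≡ w ⊕ 1
    adjacent-simple sv (inj₁ e) = inj₁ e
    adjacent-simple sv (inj₂ (inj₁ e)) = inj₂ e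
    adjacent-simple sv (inj₂ (inj₂ (inj₁ vw))) = contradiction refl (proj₁ (sv vw))
    adjacent-simple sv (inj₂ (inj₂ (inj₂ wv))) = contradiction refl (proj₂ (sv wv))

    simple-intro : ∀ {v} → (∀ {w} → Chord (diags T) v w → ¬ IsDiagonal (v , w)) → Simple T v
    simple-intro no-diagonal mem =
      (λ { refl → no-diagonal (inj₁ mem) (All.lookup (areDiags T) mem) }) ,
      (λ { refl → no-diagonal (inj₂ mem) (IsDiagonal-swap (All.lookup (areDiags T) mem)) })

    interleaved-chords : (x : Fin N) → ∀ {P Q R S} → P < Q → Q < R → R < S → S < P + N →
                         Chord (diags T) (x ⊕ P) (x ⊕ R) → ¬ Chord (diags T) (x ⊕ Q) (x ⊕ S)
    interleaved-chords x {P} {Q} {R} {S} P<Q Q<R R<S S<P+N = excluded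
      where
      crossing : Crosses (x ⊕ P , x ⊕ R) (x ⊕ Q , x ⊕ S)
      crossing = interleaved-Crosses x P<Q Q<R R<S S<P+N
      -- (R , S , P + N , Q + N) is interleaved as well
      crossing′ : Crosses (x ⊕ R , x ⊕ P) (x ⊕ S , x ⊕ Q)
      crossing′ = subst₂ Crosses (cong (x ⊕ R ,_) (⊕-periodic x P)) (cong (x ⊕ S ,_) (⊕-periodic x Q))
        (interleaved-Crosses x R<S S<P+N (+-monoˡ-< N P<Q) (+-monoˡ-< N Q<R))
      excluded : Chord (diags T) (x ⊕ P) (x ⊕ R) → ¬ Chord (diags T) (x ⊕ Q) (x ⊕ S)
      excluded (inj₁ pr) (inj₁ qs) = nonCross T pr qs crossing
      excluded (inj₁ pr) (inj₂ sq) = nonCross T pr sq (Crosses-swapʳ crossing)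
      excluded (inj₂ rp) (inj₁ qs) = nonCross T rp qs (Crosses-swapʳ crossing′)
      excluded (inj₂ rp) (inj₂ sq) = nonCross T rp sq crossing′

  scan-first : ∀ ds (a : Fin N) f k {j₀} → k ≤ j₀ → j₀ < k + f → T (joined ds a (a ⊕ j₀)) →
               ∃[ j ] j ≤ j₀ × scan ds a f k ≡ a ⊕ j × LeastFrom (λ j → T (joined ds a (a ⊕ j))) k j
  scan-first ds a zero k k≤j₀ j₀<k+0 _ =
    contradiction (≤-<-trans k≤j₀ j₀<k+0) (<-irrefl (sym (+-identityʳ k)))
  scan-first ds a (suc f) k {j₀} k≤j₀ j₀<k+1+f found with joined ds a (a ⊕ k) in eq
  ... | true = k , k≤j₀ , refl , record
    { from  = ≤-refl
    ; holds = Equivalence.from T-≡ eq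
    ; least = λ k≤i i<k → contradiction (≤-<-trans k≤i i<k) (<-irrefl refl)
    }
  ... | false with scan-first ds a f (suc k) k<j₀ (subst (j₀ <_) (+-suc k f) j₀<k+1+f) found
    where
    k<j₀ : k < j₀
    k<j₀ = ≤∧≢⇒< k≤j₀ (λ { refl → subst T eq found })
  ...   | j , j≤j₀ , scan≡ , L = j , j≤j₀ , scan≡ , LeastFrom-suc⁻ (subst T eq) L

  prevVertex-probe : ∀ (a b : Fin N) t → a ⊕ (suc (offset a b) + t) ≡ b ⊕ suc t
  prevVertex-probe a b t = begin
    a ⊕ (suc (offset a b) + t)   ≡⟨ cong (a ⊕_) (+-suc (offset a b) t) ⟨
    a ⊕ (offset a b + suc t)     ≡⟨ ⊕-+ a (offset a b) (suc t) ⟨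
    (a ⊕ offset a b) ⊕ suc t     ≡⟨ cong (_⊕ suc t) (⊕-offset a b) ⟩
    b ⊕ suc t                    ∎
    where open ≡-Reasoning

  module _ (x : Fin N) (ds : List (Fin N × Fin N)) (a : Fin N) where

    prevVertex-⊕ : ∀ B t₀ → t₀ < N → Adjacent ds a (x ⊕ (suc B + t₀)) →
                   ∃[ Y ] Y ≤ suc B + t₀ × prevVertex ds a (x ⊕ B) ≡ x ⊕ Y ×
                          LeastFrom (λ Y → Adjacent ds a (x ⊕ Y)) (suc B) Y
    prevVertex-⊕ B t₀ t₀<N adj = located (scan-first ds a N (suc o) (m≤m+n (suc o) t₀)
                                             (+-monoʳ-< (suc o) t₀<N) (Equivalence.from joined⇔Adjacent adj′))
      where
      o : ℕ
      o = offset a (x ⊕ B)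
      probe : ∀ t → a ⊕ (suc o + t) ≡ x ⊕ (suc B + t)
      probe t = trans (prevVertex-probe a (x ⊕ B) t) (trans (⊕-+ x B (suc t)) (cong (x ⊕_) (+-suc B t)))
      adj′ : Adjacent ds a (a ⊕ (suc o + t₀))
      adj′ = subst (Adjacent ds a) (sym (probe t₀)) adj
      located : ∃[ j ] j ≤ suc o + t₀ × scan ds a N (suc o) ≡ a ⊕ j ×
                       LeastFrom (λ j → T (joined ds a (a ⊕ j))) (suc o) j →
                ∃[ Y ] Y ≤ suc B + t₀ × prevVertex ds a (x ⊕ B) ≡ x ⊕ Y ×
                       LeastFrom (λ Y → Adjacent ds a (x ⊕ Y)) (suc B) Y
      located (j , j≤ , scan≡ , L) with m≤n⇒∃[o]m+o≡n (LeastFrom.from L)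
      ... | t , refl =
        suc B + t , +-monoʳ-≤ (suc B) (+-cancelˡ-≤ (suc o) t t₀ j≤) , trans scan≡ (probe t) , record
        { from  = m≤m+n (suc B) t
        ; holds = subst (Adjacent ds a) (probe t) (Equivalence.to joined⇔Adjacent (LeastFrom.holds L))
        ; least = least
        }
        where
        least : ∀ {i} → suc B ≤ i → i < suc B + t → ¬ Adjacent ds a (x ⊕ i)
        least B<i i<B+t with m≤n⇒∃[o]m+o≡n B<i
        ... | s , refl = LeastFrom.least L (m≤m+n (suc o) s) (+-monoʳ-< (suc o) (+-cancelˡ-< (suc B) s t i<B+t))
                           ∘ Equivalence.from joined⇔Adjacent ∘ subst (Adjacent ds a) (sym (probe s))

    prevVertex-before : ∀ {A B} → a ≡ x ⊕ A → suc B < A → A ≤ B + N →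
                        ∃[ Y ] Y < A × prevVertex ds a (x ⊕ B) ≡ x ⊕ Y ×
                               LeastFrom (λ Y → Adjacent ds a (x ⊕ Y)) (suc B) Y
    prevVertex-before {A} {B} a≡ B+1<A A≤B+N with m≤n⇒∃[o]m+o≡n B+1<A
    ... | g , refl = Prod.map₂ (Prod.map₁ s≤s)
                       (prevVertex-⊕ B g g<N (inj₂ (inj₁ (trans a≡ (sym (⊕-suc x (suc B + g)))))))
      where
      g<N : g < N
      g<N = +-cancelˡ-< B g N (<-trans (+-monoʳ-< B (n<1+n g)) (subst (_≤ B + N) (cong suc (sym (+-suc B g))) A≤B+N))

  module Strand (T : Tiling N) (x : Fin N) where

    -- A strand entering a tile through its side (x ⊕ A , x ⊕ B) near x ⊕ A;
    -- only the initial side (N , 1) is a boundary edge.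
    record Entry (A B : ℕ) : Set where
      field
        1≤B   : 1 ≤ B
        2+B≤A : 2 + B ≤ A
        A≤N   : A ≤ N
        chord : A < N → Chord (diags T) (x ⊕ A) (x ⊕ B)

    record Turn (A B : ℕ) : Set where
      field
        D C     : ℕ
        D<A     : D < A
        C<D     : C < D
        prev-a  : prevVertex (diags T) (x ⊕ A) (x ⊕ B) ≡ x ⊕ D
        prev-d  : prevVertex (diags T) (x ⊕ D) (x ⊕ A) ≡ x ⊕ C
        first-D : LeastFrom (λ Y → Adjacent (diags T) (x ⊕ A) (x ⊕ Y)) (suc B) D
        first-C : LeastFrom (λ Y → Adjacent (diags T) (x ⊕ D) (x ⊕ Y)) 1 C

    -- A side [d , y] with y on the arc (a , x] would cross the diagonal [b , a].
    no-Adjacent-beyond : ∀ {A B D Y} → Entry A B → suc B ≤ D → D < A → A < Y → Y ≤ N →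
                         ¬ Adjacent (diags T) (x ⊕ D) (x ⊕ Y)
    no-Adjacent-beyond {D = D} {Y} e B<D D<A A<Y Y≤N (inj₁ y≡d⁺) =
      ⊕-distinct x D+1<Y (≤-<-trans Y≤N (m<n+m N z<s)) (sym (trans y≡d⁺ (⊕-suc x D)))
      where
      D+1<Y : suc D < Y
      D+1<Y = ≤-<-trans D<A A<Y
    no-Adjacent-beyond {D = D} {Y} e B<D D<A A<Y Y≤N (inj₂ (inj₁ d≡y⁺)) =
      ⊕-distinct x D<Y+1 Y+1<D+N (trans d≡y⁺ (⊕-suc x Y))
      where
      D<Y+1 : D < suc Y
      D<Y+1 = <-trans D<A (<-trans A<Y (n<1+n Y))
      Y+1<D+N : suc Y < D + N
      Y+1<D+N = +-mono-≤ (≤-trans (s≤s (Entry.1≤B e)) B<D) Y≤N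
    no-Adjacent-beyond e B<D D<A A<Y Y≤N (inj₂ (inj₂ dy)) =
      interleaved-chords T x B<D D<A A<Y (≤-<-trans Y≤N (m<n+m N (Entry.1≤B e)))
        (Sum.swap (Entry.chord e (<-≤-trans A<Y Y≤N))) dy

    prevVertex-wraps : ∀ {A B D} → Entry A B → suc B ≤ D → D < A →
                       ∃[ C ] C < D × prevVertex (diags T) (x ⊕ D) (x ⊕ A) ≡ x ⊕ C ×
                              LeastFrom (λ Y → Adjacent (diags T) (x ⊕ D) (x ⊕ Y)) 1 C
    prevVertex-wraps {A} {B} {D} e B<D D<A =
      wrap (prevVertex-before x (diags T) (x ⊕ D) (sym (⊕-periodic x D)) A+1<D+N (+-monoˡ-≤ N (<⇒≤ D<A)))
      where
      A+1<D+N : suc A < D + N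
      A+1<D+N = +-mono-≤ (≤-trans (s≤s (Entry.1≤B e)) B<D) (Entry.A≤N e)
      wrap : ∃[ Y ] Y < D + N × prevVertex (diags T) (x ⊕ D) (x ⊕ A) ≡ x ⊕ Y ×
                    LeastFrom (λ Y → Adjacent (diags T) (x ⊕ D) (x ⊕ Y)) (suc A) Y →
             ∃[ C ] C < D × prevVertex (diags T) (x ⊕ D) (x ⊕ A) ≡ x ⊕ C ×
                    LeastFrom (λ Y → Adjacent (diags T) (x ⊕ D) (x ⊕ Y)) 1 C
      wrap (Y , Y<D+N , prev≡ , L) with Y ≤? N
      ... | yes Y≤N = contradiction (LeastFrom.holds L) (no-Adjacent-beyond e B<D D<A (LeastFrom.from L) Y≤N)
      ... | no Y≰N with m≤n⇒∃[o]m+o≡n (≰⇒> Y≰N)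
      ...   | c , refl = suc c , C<D , trans prev≡ unwrap , record
        { from  = s≤s z≤n
        ; holds = subst (Adjacent (diags T) (x ⊕ D)) unwrap (LeastFrom.holds L)
        ; least = λ {i} 1≤i i<C →
            LeastFrom.least L (+-mono-≤ 1≤i (Entry.A≤N e)) (subst (i + N <_) (cong suc (+-comm c N)) (+-monoˡ-< N i<C))
              ∘ subst (Adjacent (diags T) (x ⊕ D)) (sym (⊕-periodic x i))
        }
        where
        unwrap : x ⊕ (suc N + c) ≡ x ⊕ suc c
        unwrap = trans (cong (x ⊕_) (cong suc (+-comm N c))) (⊕-periodic x (suc c))
        C<D : suc c < D
        C<D = +-cancelʳ-< N (suc c) D (subst (_< D + N) (cong suc (+-comm N c)) Y<D+N)

    turn : ∀ {A B} → Entry A B → Turn A B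
    turn {A} {B} e
      with prevVertex-before x (diags T) (x ⊕ A) refl (Entry.2+B≤A e) (≤-trans (Entry.A≤N e) (m≤n+m N B))
    ... | D , D<A , prev-a , first-D with prevVertex-wraps e (LeastFrom.from first-D) D<A
    ...   | C , C<D , prev-d , first-C = record
      { D = D ; C = C ; D<A = D<A ; C<D = C<D
      ; prev-a = prev-a ; prev-d = prev-d ; first-D = first-D ; first-C = first-C }

    module _ {A B} (t : Turn A B) (f : ℕ) where
      open Turn t

      walk-stops : x ⊕ D ≡ (x ⊕ C) ⊕ 1 → walk (diags T) (suc f) (x ⊕ A) (x ⊕ B) ≡ x ⊕ D
      walk-stops d≡c⁺ rewrite prev-a | prev-d with x ⊕ D ≟ (x ⊕ C) ⊕ 1
      ... | yes _    = refl
      ... | no d≢c⁺  = contradiction d≡c⁺ d≢c⁺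

      walk-continues : x ⊕ D ≢ (x ⊕ C) ⊕ 1 →
                       walk (diags T) (suc f) (x ⊕ A) (x ⊕ B) ≡ walk (diags T) f (x ⊕ D) (x ⊕ C)
      walk-continues d≢c⁺ rewrite prev-a | prev-d with x ⊕ D ≟ (x ⊕ C) ⊕ 1
      ... | yes d≡c⁺ = contradiction d≡c⁺ d≢c⁺
      ... | no _     = refl

    Turn-c≢d⁺ : ∀ {A B} → A ≤ N → (t : Turn A B) → let open Turn t in x ⊕ C ≢ (x ⊕ D) ⊕ 1
    Turn-c≢d⁺ A≤N t c≡d⁺ =
      ⊕-distinct x (≤-trans C<D (n≤1+n D)) (≤-<-trans (≤-trans D<A A≤N) (m<n+m N (LeastFrom.from first-C)))
        (trans c≡d⁺ (⊕-suc x D))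
      where open Turn t

    next-Entry : ∀ {A B} → Entry A B → (t : Turn A B) → let open Turn t in
                 x ⊕ D ≢ (x ⊕ C) ⊕ 1 → Entry D C
    next-Entry e t d≢c⁺ = record
      { 1≤B   = LeastFrom.from first-C
      ; 2+B≤A = ≤∧≢⇒< C<D (λ 1+C≡D → d≢c⁺ (trans (cong (x ⊕_) (sym 1+C≡D)) (sym (⊕-suc x C))))
      ; A≤N   = ≤-trans (<⇒≤ D<A) (Entry.A≤N e)
      ; chord = λ _ → chord-dc (LeastFrom.holds first-C)
      }
      where
      open Turn t
      chord-dc : Adjacent (diags T) (x ⊕ D) (x ⊕ C) → Chord (diags T) (x ⊕ D) (x ⊕ C)
      chord-dc (inj₁ c≡d⁺) = contradiction c≡d⁺ (Turn-c≢d⁺ (Entry.A≤N e) t)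
      chord-dc (inj₂ (inj₁ d≡c⁺)) = contradiction d≡c⁺ d≢c⁺
      chord-dc (inj₂ (inj₂ dc)) = dc

    walk-descends : ∀ {A B} → Entry A B → ∀ f → A ≤ f →
                    ∃[ R ] R < A × walk (diags T) f (x ⊕ A) (x ⊕ B) ≡ x ⊕ R
    walk-descends e zero A≤0 = contradiction (≤-trans (Entry.2+B≤A e) A≤0) λ ()
    walk-descends {A} {B} e (suc f) A≤1+f = descend (turn e)
      where
      descend : Turn A B → ∃[ R ] R < A × walk (diags T) (suc f) (x ⊕ A) (x ⊕ B) ≡ x ⊕ R
      descend t = case (x ⊕ D ≟ (x ⊕ C) ⊕ 1)
        where
        open Turn t
        case : Dec (x ⊕ D ≡ (x ⊕ C) ⊕ 1) → ∃[ R ] R < A × walk (diags T) (suc f) (x ⊕ A) (x ⊕ B) ≡ x ⊕ R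
        case (yes d≡c⁺) = D , D<A , walk-stops t f d≡c⁺
        case (no d≢c⁺) = Prod.map₂ (Prod.map (λ R<D → <-trans R<D D<A) (trans (walk-continues t f d≢c⁺)))
                           (walk-descends (next-Entry e t d≢c⁺) f (≤-pred (≤-trans D<A A≤1+f)))

  module ScottStrand (T : Tiling N) (x : Fin N) (2≤m : 2 ≤ m) where
    open Strand T x

    start : Entry N 1
    start = record
      { 1≤B = ≤-refl ; 2+B≤A = s≤s 2≤m ; A≤N = ≤-refl ; chord = λ N<N → contradiction N<N (<-irrefl refl) }

    module FirstTurn (t : Turn N 1) where
      open Turn t

      -- the fuel 3 * N of Scott reduces to suc (m + 2 * N)
      Scott≡walk : Scott T x ≡ walk (diags T) (suc (m + 2 * N)) (x ⊕ N) (x ⊕ 1)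
      Scott≡walk = cong (λ v → walk (diags T) (suc (m + 2 * N)) v (x ⊕ 1)) (sym (⊕-N x))

      Scott-stops : x ⊕ D ≡ (x ⊕ C) ⊕ 1 → Scott T x ≡ x ⊕ D
      Scott-stops d≡c⁺ = trans Scott≡walk (walk-stops t (m + 2 * N) d≡c⁺)

      Scott-descends : x ⊕ D ≢ (x ⊕ C) ⊕ 1 → ∃[ R ] R < D × Scott T x ≡ x ⊕ R
      Scott-descends d≢c⁺ = Prod.map₂ (Prod.map₂ (trans (trans Scott≡walk (walk-continues t (m + 2 * N) d≢c⁺))))
        (walk-descends (next-Entry start t d≢c⁺) (m + 2 * N) (≤-trans (≤-pred D<A) (m≤m+n m (2 * N))))

      d≡c⁺⇒1+C≡D : x ⊕ D ≡ (x ⊕ C) ⊕ 1 → suc C ≡ D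
      d≡c⁺⇒1+C≡D d≡c⁺ =
        ⊕-injective x C<D (<-≤-trans D<A (m≤n+m N (suc C))) (trans (sym (⊕-suc x C)) (sym d≡c⁺))

      1+C≡D⇒d≡c⁺ : suc C ≡ D → x ⊕ D ≡ (x ⊕ C) ⊕ 1
      1+C≡D⇒d≡c⁺ 1+C≡D = trans (cong (x ⊕_) (sym 1+C≡D)) (sym (⊕-suc x C))

      Scott≡x⊕m⇒ : Scott T x ≡ x ⊕ m → D ≡ m × suc C ≡ D
      Scott≡x⊕m⇒ scott≡ = case (x ⊕ D ≟ (x ⊕ C) ⊕ 1)
        where
        case : Dec (x ⊕ D ≡ (x ⊕ C) ⊕ 1) → D ≡ m × suc C ≡ D
        case (yes d≡c⁺) =
          ⊕-injective x (≤-pred D<A) (<-≤-trans (n<1+n m) (m≤n+m N D)) (trans (sym (Scott-stops d≡c⁺)) scott≡) ,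
          d≡c⁺⇒1+C≡D d≡c⁺
        case (no d≢c⁺) = below (Scott-descends d≢c⁺)
          where
          below : ∃[ R ] R < D × Scott T x ≡ x ⊕ R → D ≡ m × suc C ≡ D
          below (R , R<D , scott≡r) = contradiction (trans (sym scott≡r) scott≡)
            (⊕-distinct x (<-≤-trans R<D (≤-pred D<A)) (<-≤-trans (n<1+n m) (m≤n+m N R)))

      simple⇒D≡m : Simple T x → D ≡ m
      simple⇒D≡m sx
        with adjacent-simple T sx (subst (λ v → Adjacent (diags T) v (x ⊕ D)) (⊕-N x) (LeastFrom.holds first-D))
      ... | inj₁ d≡x⁺ =
        contradiction (sym d≡x⁺) (⊕-distinct x (LeastFrom.from first-D) (<-≤-trans D<A (m≤n+m N 1)))
      ... | inj₂ x≡d⁺ = suc-injective (⊕-injective x D<A (m<n+m N z<s)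
                          (trans (sym (⊕-suc x D)) (trans (sym x≡d⁺) (sym (⊕-N x)))))

      D≡m⇒simple : D ≡ m → Simple T x
      D≡m⇒simple D≡m = simple-intro T no-diagonal
        where
        no-diagonal : ∀ {y} → Chord (diags T) x y → ¬ IsDiagonal (x , y)
        no-diagonal {y} xy (x≢y , y≢x⁺ , x≢y⁺) =
          LeastFrom.least first-D (proj₁ Y-bounds) (proj₂ Y-bounds)
            (inj₂ (inj₂ (subst₂ (Chord (diags T)) (sym (⊕-N x)) (sym (⊕-offset x y)) xy)))
          where
          bounds : ∀ Y → x ⊕ Y ≡ y → Y < N → 2 ≤ Y × Y < D
          bounds zero x≡y _ = contradiction (trans (sym (⊕-identityʳ x)) x≡y) x≢y
          bounds (suc zero) x⁺≡y _ = contradiction (sym x⁺≡y) y≢x⁺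
          bounds Y@(suc (suc _)) x⊕Y≡y Y<N =
            s≤s (s≤s z≤n) , subst (Y <_) (sym D≡m) (≤∧≢⇒< (≤-pred Y<N) Y≢m)
            where
            Y≢m : Y ≢ m
            Y≢m Y≡m = x≢y⁺ (begin
              x              ≡⟨ ⊕-N x ⟨
              x ⊕ suc m      ≡⟨ cong (x ⊕_ ∘ suc) Y≡m ⟨
              x ⊕ suc Y      ≡⟨ ⊕-suc x Y ⟨
              (x ⊕ Y) ⊕ 1    ≡⟨ cong (_⊕ 1) x⊕Y≡y ⟩
              y ⊕ 1          ∎)
              where open ≡-Reasoning
          Y-bounds : 2 ≤ offset x y × offset x y < D
          Y-bounds = bounds (offset x y) (⊕-offset x y) (offset<N x y)

      simple⇒1+C≡D : Simple T (x ⊕ D) → suc C ≡ D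
      simple⇒1+C≡D sd with adjacent-simple T sd (LeastFrom.holds first-C)
      ... | inj₁ c≡d⁺ = contradiction c≡d⁺ (Turn-c≢d⁺ ≤-refl t)
      ... | inj₂ d≡c⁺ = d≡c⁺⇒1+C≡D d≡c⁺

      1+C≡D⇒simple : D ≡ m → suc C ≡ D → Simple T (x ⊕ D)
      1+C≡D⇒simple D≡m 1+C≡D = simple-intro T no-diagonal
        where
        no-diagonal : ∀ {y} → Chord (diags T) (x ⊕ D) y → ¬ IsDiagonal (x ⊕ D , y)
        no-diagonal {y} dy (d≢y , y≢d⁺ , d≢y⁺) =
          LeastFrom.least first-C (proj₁ Y-bounds) (proj₂ Y-bounds)
            (inj₂ (inj₂ (subst (Chord (diags T) (x ⊕ D)) (sym (⊕-offset x y)) dy)))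
          where
          bounds : ∀ Y → x ⊕ Y ≡ y → Y < N → 1 ≤ Y × Y < C
          bounds zero x⊕0≡y _ = contradiction (begin
            y                ≡⟨ x⊕0≡y ⟨
            x ⊕ 0            ≡⟨ ⊕-identityʳ x ⟩
            x                ≡⟨ ⊕-N x ⟨
            x ⊕ suc m        ≡⟨ cong (x ⊕_ ∘ suc) D≡m ⟨
            x ⊕ suc D        ≡⟨ ⊕-suc x D ⟨
            (x ⊕ D) ⊕ 1      ∎) y≢d⁺
            where open ≡-Reasoning
          bounds Y@(suc _) x⊕Y≡y Y<N =
            s≤s z≤n , ≤-pred (subst (suc Y <_) (sym 1+C≡D) (≤∧≢⇒< Y<D Y+1≢D))
            where
            Y<D : Y < D
            Y<D = ≤∧≢⇒< (subst (Y ≤_) (sym D≡m) (≤-pred Y<N))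
                        (λ Y≡D → d≢y (trans (cong (x ⊕_) (sym Y≡D)) x⊕Y≡y))
            Y+1≢D : suc Y ≢ D
            Y+1≢D Y+1≡D = d≢y⁺ (begin
              x ⊕ D          ≡⟨ cong (x ⊕_) Y+1≡D ⟨
              x ⊕ suc Y      ≡⟨ ⊕-suc x Y ⟨
              (x ⊕ Y) ⊕ 1    ≡⟨ cong (_⊕ 1) x⊕Y≡y ⟩
              y ⊕ 1          ∎)
              where open ≡-Reasoning
          Y-bounds : 1 ≤ offset x y × offset x y < C
          Y-bounds = bounds (offset x y) (⊕-offset x y) (offset<N x y)

      Scott≡x⊕m⇔Simple : Scott T x ≡ x ⊕ m ⇔ (Simple T (x ⊕ m) × Simple T x)
      Scott≡x⊕m⇔Simple = mk⇔ to from
        where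
        to : Scott T x ≡ x ⊕ m → Simple T (x ⊕ m) × Simple T x
        to scott≡ = let D≡m , 1+C≡D = Scott≡x⊕m⇒ scott≡ in
          subst (Simple T ∘ (x ⊕_)) D≡m (1+C≡D⇒simple D≡m 1+C≡D) , D≡m⇒simple D≡m
        from : Simple T (x ⊕ m) × Simple T x → Scott T x ≡ x ⊕ m
        from (s-x⊕m , s-x) = let D≡m = simple⇒D≡m s-x in
          trans (Scott-stops (1+C≡D⇒d≡c⁺ (simple⇒1+C≡D (subst (Simple T ∘ (x ⊕_)) (sym D≡m) s-x⊕m))))
                (cong (x ⊕_) D≡m)

    open FirstTurn (turn start) public using (Scott≡x⊕m⇔Simple)

mainTheorem10 : (n : ℕ) → 3 ≤ n → (T : Tiling n) → (i : Fin n) →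
    (Scott T (i ⊕ 1) ≡ i) ⇔ SimpleEdge T i
mainTheorem10 (suc m) (s≤s 2≤m) T i =
  subst (λ v → (Scott T (i ⊕ 1) ≡ v) ⇔ (Simple T v × Simple T (i ⊕ 1)))
        (trans (⊕-+ i 1 m) (⊕-N i))
        (ScottStrand.Scott≡x⊕m⇔Simple T (i ⊕ 1) 2≤m)
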